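{- Let $p$ be a prime and let $m,\ell$ be positive integers. Let $\alpha,s$ be positive integers with $\alpha-s\geq 0$, and let $r$ be an integer with $1\leq r\leq p^s-1$. Then for all integers $n\geq 0$, \[ T_{\ell,p^\alpha m}(p^s n+r)\equiv 0\pmod{p^{\alpha-s+1}}. \]
   Context: A partition of a non-negative integer $n$ is $\ell$-regular if none of its parts is divisible by $\ell$ (the empty partition of $0$ counts). A $k$-tuple $\ell$-regular partition of $n$ is a sequence $(\lambda_1,\dots,\lambda_k)$ where $\lambda_i$ is an $\ell$-regular partition of $n_i\ge 0$ and $n_1+\cdots+n_k=n$. $T_{\ell,k}(n)$ denotes the number of $k$-tuple $\ell$-regular partitions of $n$. Equivalently, $\sum_{n\ge0}T_{\ell,k}(n)q^n=\prod_{i\ge1}\frac{(1-q^{\ell i})^k}{(1-q^i)^k}$. -}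

module Defs where

open import Data.Nat using (ℕ; zero; suc; _+_; _*_; _∸_; _≤?_; _^_)
open import Data.Nat.Divisibility using (_∣?_)
open import Relation.Nullary using (yes; no)

-- parts-upto ℓ b n : number of ℓ-regular partitions of n all of whose parts
-- are ≤ b (a partition = multiset of positive parts; ℓ-regular = no part
-- divisible by ℓ).
-- Recursion on the largest allowed part size b: either no part equals b,
-- or (when ℓ ∤ b) at least one part equals b, remove one copy.
-- The extra argument 'fuel' (≥ n) makes the recursion on n structural.
mutual
  partsUpto : ℕ → ℕ → ℕ → ℕ
  partsUpto ℓ b n = go ℓ b n n

  go : ℕ → ℕ → ℕ → ℕ → ℕ
  go ℓ zero    zero    fuel = 1
  go ℓ zero    (suc n) fuel = 0
  go ℓ (suc b) n fuel = go ℓ b n fuel + withPart ℓ b n fuel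

  withPart : ℕ → ℕ → ℕ → ℕ → ℕ
  withPart ℓ b n zero = 0
  withPart ℓ b n (suc fuel) with ℓ ∣? suc b | suc b ≤? n
  ... | yes _ | _     = 0
  ... | no _  | no _  = 0
  ... | no _  | yes _ = go ℓ (suc b) (n ∸ suc b) fuel

regPart : ℕ → ℕ → ℕ
regPart ℓ n = partsUpto ℓ n n

sumTo : ℕ → (ℕ → ℕ) → ℕ
sumTo zero    f = f 0
sumTo (suc n) f = sumTo n f + f (suc n)

-- T ℓ k n : number of k-tuples (λ₁,…,λ_k) of ℓ-regular partitions with
-- |λ₁| + … + |λ_k| = n; the tuple is split as λ₁ (of size i) followed by a
-- (k-1)-tuple of total size n - i.
T : ℕ → ℕ → ℕ → ℕ
T ℓ zero    zero    = 1
T ℓ zero    (suc n) = 0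
T ℓ (suc k) n = sumTo n (λ i → regPart ℓ i * T ℓ k (n ∸ i))

{-# OPTIONS --safe #-}
module Submission where

open import Defs
open import Data.Nat using (ℕ; zero; suc; _+_; _*_; _∸_; _^_; _≤_; _<_; z≤n; NonZero; >-nonZero)
open import Data.Nat.Properties
open import Data.Nat.Divisibility
open import Data.Nat.Primality using (Prime; euclidsLemma; prime⇒nonZero)
open import Data.Nat.Tactic.RingSolver using (solve-∀)
open import Algebra.Properties.CommutativeSemigroup +-commutativeSemigroup using (interchange)
open import Data.Sum using (inj₁; inj₂)
open import Function using (_∘_)
open import Relation.Nullary using (¬_; yes; no; contradiction)
open import Relation.Binary.PropositionalEquality
open ≡-Reasoning

-- With F = ∏ (1 - q^{ℓi}) / (1 - q^i), the generating function of
-- T_{ℓ,k} is F^k, and q d/dq (F^k) = k F^{k-1} · q F' shows that k divides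
-- n T_{ℓ,k}(n) for every n.  For k = p^α m we get p^α ∣ n T_{ℓ,k}(n), while
-- n = p^s n' + r is not divisible by p^s, so n absorbs at most s - 1 factors
-- of p and the remaining p^{α-s+1} divide T_{ℓ,k}(n).

sumTo-cong : ∀ n {f g : ℕ → ℕ} → (∀ {i} → i ≤ n → f i ≡ g i) → sumTo n f ≡ sumTo n g
sumTo-cong zero    f≗g = f≗g z≤n
sumTo-cong (suc n) f≗g = cong₂ _+_ (sumTo-cong n (f≗g ∘ m≤n⇒m≤1+n)) (f≗g ≤-refl)

sumTo-distrib-+ : ∀ n (f g : ℕ → ℕ) → sumTo n (λ i → f i + g i) ≡ sumTo n f + sumTo n g
sumTo-distrib-+ zero    f g = refl
sumTo-distrib-+ (suc n) f g = begin
  sumTo n (λ i → f i + g i) + (f (suc n) + g (suc n))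
    ≡⟨ cong (_+ (f (suc n) + g (suc n))) (sumTo-distrib-+ n f g) ⟩
  (sumTo n f + sumTo n g) + (f (suc n) + g (suc n))
    ≡⟨ interchange (sumTo n f) (sumTo n g) (f (suc n)) (g (suc n)) ⟩
  (sumTo n f + f (suc n)) + (sumTo n g + g (suc n)) ∎

*-distribˡ-sumTo : ∀ n c (f : ℕ → ℕ) → c * sumTo n f ≡ sumTo n (λ i → c * f i)
*-distribˡ-sumTo zero    c f = refl
*-distribˡ-sumTo (suc n) c f = begin
  c * (sumTo n f + f (suc n))       ≡⟨ *-distribˡ-+ c (sumTo n f) (f (suc n)) ⟩
  c * sumTo n f + c * f (suc n)     ≡⟨ cong (_+ c * f (suc n)) (*-distribˡ-sumTo n c f) ⟩
  sumTo n (λ i → c * f i) + c * f (suc n) ∎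

*-distribʳ-sumTo : ∀ n c (f : ℕ → ℕ) → sumTo n f * c ≡ sumTo n (λ i → f i * c)
*-distribʳ-sumTo zero    c f = refl
*-distribʳ-sumTo (suc n) c f = begin
  (sumTo n f + f (suc n)) * c       ≡⟨ *-distribʳ-+ c (sumTo n f) (f (suc n)) ⟩
  sumTo n f * c + f (suc n) * c     ≡⟨ cong (_+ f (suc n) * c) (*-distribʳ-sumTo n c f) ⟩
  sumTo n (λ i → f i * c) + f (suc n) * c ∎

sumTo-suc : ∀ n (f : ℕ → ℕ) → sumTo (suc n) f ≡ f 0 + sumTo n (f ∘ suc)
sumTo-suc zero    f = refl
sumTo-suc (suc n) f = begin
  sumTo (suc n) f + f (suc (suc n))             ≡⟨ cong (_+ f (suc (suc n))) (sumTo-suc n f) ⟩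
  f 0 + sumTo n (f ∘ suc) + f (suc (suc n))     ≡⟨ +-assoc (f 0) _ _ ⟩
  f 0 + sumTo (suc n) (f ∘ suc)                 ∎

sumTo-reverse : ∀ n (f : ℕ → ℕ) → sumTo n f ≡ sumTo n (λ i → f (n ∸ i))
sumTo-reverse zero    f = refl
sumTo-reverse (suc n) f = begin
  sumTo n f + f (suc n)                     ≡⟨ cong (_+ f (suc n)) (sumTo-reverse n f) ⟩
  sumTo n (λ i → f (n ∸ i)) + f (suc n)     ≡⟨ +-comm _ (f (suc n)) ⟩
  f (suc n) + sumTo n (λ i → f (n ∸ i))     ≡⟨ sumTo-suc n (λ i → f (suc n ∸ i)) ⟨
  sumTo (suc n) (λ i → f (suc n ∸ i))       ∎

sumTo-offset-suc : ∀ {j n} → j ≤ n → (h : ℕ → ℕ) →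
  sumTo (suc n ∸ j) (λ k → h (j + k)) ≡ sumTo (n ∸ j) (λ k → h (j + k)) + h (suc n)
sumTo-offset-suc {j} {n} j≤n h = begin
  sumTo (suc n ∸ j) (λ k → h (j + k))
    ≡⟨ cong (λ m → sumTo m (λ k → h (j + k))) (+-∸-assoc 1 j≤n) ⟩
  sumTo (n ∸ j) (λ k → h (j + k)) + h (j + suc (n ∸ j))
    ≡⟨ cong (λ m → sumTo (n ∸ j) (λ k → h (j + k)) + h m) j+[1+n∸j]≡1+n ⟩
  sumTo (n ∸ j) (λ k → h (j + k)) + h (suc n) ∎
  where
  j+[1+n∸j]≡1+n : j + suc (n ∸ j) ≡ suc n
  j+[1+n∸j]≡1+n = trans (+-suc j (n ∸ j)) (cong suc (m+[n∸m]≡n j≤n))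

sumTo-triangle : ∀ n (F : ℕ → ℕ → ℕ) →
  sumTo n (λ i → sumTo i (F i)) ≡ sumTo n (λ j → sumTo (n ∸ j) (λ k → F (j + k) j))
sumTo-triangle zero    F = refl
sumTo-triangle (suc n) F = begin
  sumTo n (λ i → sumTo i (F i)) + (sumTo n (F (suc n)) + F (suc n) (suc n))
    ≡⟨ cong (_+ (sumTo n (F (suc n)) + F (suc n) (suc n))) (sumTo-triangle n F) ⟩
  columns n + (sumTo n (F (suc n)) + F (suc n) (suc n))
    ≡⟨ +-assoc (columns n) _ _ ⟨
  columns n + sumTo n (F (suc n)) + F (suc n) (suc n)
    ≡⟨ cong₂ _+_ (sumTo-distrib-+ n _ _) diagonal ⟨
  sumTo n (λ j → sumTo (n ∸ j) (λ k → F (j + k) j) + F (suc n) j)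
    + sumTo (n ∸ n) (λ k → F (suc n + k) (suc n))
    ≡⟨ cong (_+ sumTo (n ∸ n) (λ k → F (suc n + k) (suc n)))
            (sumTo-cong n (λ {j} j≤n → sumTo-offset-suc j≤n (λ m → F m j))) ⟨
  columns (suc n) ∎
  where
  columns : ℕ → ℕ
  columns m = sumTo m (λ j → sumTo (m ∸ j) (λ k → F (j + k) j))
  diagonal : sumTo (n ∸ n) (λ k → F (suc n + k) (suc n)) ≡ F (suc n) (suc n)
  diagonal rewrite n∸n≡0 n | +-identityʳ n = refl

infixl 7 _⋆_

_⋆_ : (ℕ → ℕ) → (ℕ → ℕ) → ℕ → ℕ
(f ⋆ g) n = sumTo n (λ i → f i * g (n ∸ i))

⋆-congˡ : ∀ {f f′} g → (∀ i → f i ≡ f′ i) → ∀ n → (f ⋆ g) n ≡ (f′ ⋆ g) n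
⋆-congˡ g f≗f′ n = sumTo-cong n (λ {i} _ → cong (_* g (n ∸ i)) (f≗f′ i))

⋆-congʳ : ∀ f {g g′} → (∀ i → g i ≡ g′ i) → ∀ n → (f ⋆ g) n ≡ (f ⋆ g′) n
⋆-congʳ f g≗g′ n = sumTo-cong n (λ {i} _ → cong (f i *_) (g≗g′ (n ∸ i)))

⋆-comm : ∀ f g n → (f ⋆ g) n ≡ (g ⋆ f) n
⋆-comm f g n = begin
  sumTo n (λ i → f i * g (n ∸ i))               ≡⟨ sumTo-reverse n _ ⟩
  sumTo n (λ i → f (n ∸ i) * g (n ∸ (n ∸ i)))   ≡⟨ sumTo-cong n swap ⟩
  sumTo n (λ i → g i * f (n ∸ i))               ∎
  where
  swap : ∀ {i} → i ≤ n → f (n ∸ i) * g (n ∸ (n ∸ i)) ≡ g i * f (n ∸ i)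
  swap {i} i≤n = trans (cong (λ j → f (n ∸ i) * g j) (m∸[m∸n]≡n i≤n)) (*-comm (f (n ∸ i)) (g i))

⋆-assoc : ∀ f g h n → ((f ⋆ g) ⋆ h) n ≡ (f ⋆ (g ⋆ h)) n
⋆-assoc f g h n = begin
  sumTo n (λ i → sumTo i (λ j → f j * g (i ∸ j)) * h (n ∸ i))
    ≡⟨ sumTo-cong n (λ {i} _ → *-distribʳ-sumTo i (h (n ∸ i)) _) ⟩
  sumTo n (λ i → sumTo i (λ j → f j * g (i ∸ j) * h (n ∸ i)))
    ≡⟨ sumTo-triangle n (λ i j → f j * g (i ∸ j) * h (n ∸ i)) ⟩
  sumTo n (λ j → sumTo (n ∸ j) (λ k → f j * g (j + k ∸ j) * h (n ∸ (j + k))))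
    ≡⟨ sumTo-cong n (λ {j} _ → sumTo-cong (n ∸ j) (λ {k} _ → reindex j k)) ⟩
  sumTo n (λ j → sumTo (n ∸ j) (λ k → f j * (g k * h (n ∸ j ∸ k))))
    ≡⟨ sumTo-cong n (λ {j} _ → *-distribˡ-sumTo (n ∸ j) (f j) _) ⟨
  sumTo n (λ j → f j * sumTo (n ∸ j) (λ k → g k * h (n ∸ j ∸ k))) ∎
  where
  reindex : ∀ j k → f j * g (j + k ∸ j) * h (n ∸ (j + k)) ≡ f j * (g k * h (n ∸ j ∸ k))
  reindex j k rewrite m+n∸m≡n j k | ∸-+-assoc n j k = *-assoc (f j) (g k) _

⋆-scaleʳ : ∀ f g c n → (f ⋆ (λ i → c * g i)) n ≡ c * (f ⋆ g) n
⋆-scaleʳ f g c n = begin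
  sumTo n (λ i → f i * (c * g (n ∸ i)))   ≡⟨ sumTo-cong n (λ {i} _ → x*[y*z]≡y*[x*z] (f i) c (g (n ∸ i))) ⟩
  sumTo n (λ i → c * (f i * g (n ∸ i)))   ≡⟨ *-distribˡ-sumTo n c _ ⟨
  c * (f ⋆ g) n                           ∎
  where
  x*[y*z]≡y*[x*z] : ∀ x y z → x * (y * z) ≡ y * (x * z)
  x*[y*z]≡y*[x*z] = solve-∀

⋆-leftComm : ∀ f g h n → (f ⋆ (g ⋆ h)) n ≡ (g ⋆ (f ⋆ h)) n
⋆-leftComm f g h n = begin
  (f ⋆ (g ⋆ h)) n   ≡⟨ ⋆-assoc f g h n ⟨
  ((f ⋆ g) ⋆ h) n   ≡⟨ ⋆-congˡ h (⋆-comm f g) n ⟩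
  ((g ⋆ f) ⋆ h) n   ≡⟨ ⋆-assoc g f h n ⟩
  (g ⋆ (f ⋆ h)) n   ∎

δ : ℕ → ℕ
δ zero    = 1
δ (suc _) = 0

infixr 8 _^⋆_

_^⋆_ : (ℕ → ℕ) → ℕ → ℕ → ℕ
f ^⋆ zero  = δ
f ^⋆ suc k = f ⋆ f ^⋆ k

-- On generating functions, ⋆ is multiplication and θ is the Euler operator q d/dq.
θ : (ℕ → ℕ) → ℕ → ℕ
θ f n = n * f n

θδ≡0 : ∀ n → θ δ n ≡ 0
θδ≡0 zero    = refl
θδ≡0 (suc n) = *-zeroʳ (suc n)

θ-⋆ : ∀ f g n → θ (f ⋆ g) n ≡ (θ f ⋆ g) n + (f ⋆ θ g) n
θ-⋆ f g n = begin
  n * sumTo n (λ i → f i * g (n ∸ i))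
    ≡⟨ *-distribˡ-sumTo n n _ ⟩
  sumTo n (λ i → n * (f i * g (n ∸ i)))
    ≡⟨ sumTo-cong n split ⟩
  sumTo n (λ i → i * f i * g (n ∸ i) + f i * ((n ∸ i) * g (n ∸ i)))
    ≡⟨ sumTo-distrib-+ n _ _ ⟩
  (θ f ⋆ g) n + (f ⋆ θ g) n ∎
  where
  product-rule : ∀ i j x y → (i + j) * (x * y) ≡ i * x * y + x * (j * y)
  product-rule = solve-∀
  split : ∀ {i} → i ≤ n → n * (f i * g (n ∸ i)) ≡ i * f i * g (n ∸ i) + f i * ((n ∸ i) * g (n ∸ i))
  split {i} i≤n = begin
    n * (f i * g (n ∸ i))               ≡⟨ cong (_* (f i * g (n ∸ i))) (m+[n∸m]≡n i≤n) ⟨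
    (i + (n ∸ i)) * (f i * g (n ∸ i))   ≡⟨ product-rule i (n ∸ i) (f i) (g (n ∸ i)) ⟩
    i * f i * g (n ∸ i) + f i * ((n ∸ i) * g (n ∸ i)) ∎

θ-^⋆ : ∀ f k n → θ (f ^⋆ suc k) n ≡ suc k * (θ f ⋆ f ^⋆ k) n
θ-^⋆ f zero n = begin
  θ (f ⋆ δ) n                   ≡⟨ θ-⋆ f δ n ⟩
  (θ f ⋆ δ) n + (f ⋆ θ δ) n     ≡⟨ cong ((θ f ⋆ δ) n +_) (⋆-congʳ f θδ≡0 n) ⟩
  (θ f ⋆ δ) n + (f ⋆ (λ _ → 0)) n ≡⟨ cong ((θ f ⋆ δ) n +_) (⋆-scaleʳ f δ 0 n) ⟩
  1 * (θ f ⋆ δ) n               ∎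
θ-^⋆ f (suc k) n = begin
  θ (f ⋆ f ^⋆ suc k) n
    ≡⟨ θ-⋆ f (f ^⋆ suc k) n ⟩
  (θ f ⋆ f ^⋆ suc k) n + (f ⋆ θ (f ^⋆ suc k)) n
    ≡⟨ cong ((θ f ⋆ f ^⋆ suc k) n +_) (⋆-congʳ f (θ-^⋆ f k) n) ⟩
  (θ f ⋆ f ^⋆ suc k) n + (f ⋆ (λ i → suc k * (θ f ⋆ f ^⋆ k) i)) n
    ≡⟨ cong ((θ f ⋆ f ^⋆ suc k) n +_) (⋆-scaleʳ f (θ f ⋆ f ^⋆ k) (suc k) n) ⟩
  (θ f ⋆ f ^⋆ suc k) n + suc k * (f ⋆ (θ f ⋆ f ^⋆ k)) n
    ≡⟨ cong (λ x → (θ f ⋆ f ^⋆ suc k) n + suc k * x) (⋆-leftComm f (θ f) (f ^⋆ k) n) ⟩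
  suc (suc k) * (θ f ⋆ f ^⋆ suc k) n ∎

k∣θ[f^⋆k] : ∀ f k n → k ∣ θ (f ^⋆ k) n
k∣θ[f^⋆k] f zero    n = ∣-reflexive (sym (θδ≡0 n))
k∣θ[f^⋆k] f (suc k) n = divides ((θ f ⋆ f ^⋆ k) n) (trans (θ-^⋆ f k n) (*-comm (suc k) _))

T≡regPart^⋆ : ∀ ℓ k n → T ℓ k n ≡ (regPart ℓ ^⋆ k) n
T≡regPart^⋆ ℓ zero    zero    = refl
T≡regPart^⋆ ℓ zero    (suc n) = refl
T≡regPart^⋆ ℓ (suc k) n       = ⋆-congʳ (regPart ℓ) (T≡regPart^⋆ ℓ k) n

module _ {p : ℕ} (p-prime : Prime p) where
  private instance
    p≢0 : NonZero p
    p≢0 = prime⇒nonZero p-prime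

  p∤m∧p^e∣m*n⇒p^e∣n : ∀ e {m n} → ¬ p ∣ m → p ^ e ∣ m * n → p ^ e ∣ n
  p∤m∧p^e∣m*n⇒p^e∣n zero    {n = n} _ _ = 1∣ n
  p∤m∧p^e∣m*n⇒p^e∣n (suc e) {m} {n} p∤m p^[1+e]∣m*n
    with euclidsLemma m n p-prime (m*n∣⇒m∣ p (p ^ e) p^[1+e]∣m*n)
  ... | inj₁ p∣m = contradiction p∣m p∤m
  ... | inj₂ (divides q refl) = ∣-trans (*-monoʳ-∣ p p^e∣q) (∣-reflexive (*-comm p q))
    where
    x*[y*z]≡z*[x*y] : ∀ x y z → x * (y * z) ≡ z * (x * y)
    x*[y*z]≡z*[x*y] = solve-∀
    p*p^e∣p*[m*q] : p * p ^ e ∣ p * (m * q)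
    p*p^e∣p*[m*q] = subst (p ^ suc e ∣_) (x*[y*z]≡z*[x*y] m q p) p^[1+e]∣m*n
    p^e∣q : p ^ e ∣ q
    p^e∣q = p∤m∧p^e∣m*n⇒p^e∣n e p∤m (*-cancelˡ-∣ p p*p^e∣p*[m*q])

  p^[1+t]∤m∧p^[t+e]∣m*n⇒p^e∣n : ∀ t e {m n} → ¬ p ^ suc t ∣ m → p ^ (t + e) ∣ m * n → p ^ e ∣ n
  p^[1+t]∤m∧p^[t+e]∣m*n⇒p^e∣n zero e {m} p*1∤m =
    p∤m∧p^e∣m*n⇒p^e∣n e (p*1∤m ∘ subst (_∣ m) (sym (*-identityʳ p)))
  p^[1+t]∤m∧p^[t+e]∣m*n⇒p^e∣n (suc t) e {m} {n} p^[2+t]∤m p^[1+t+e]∣m*n with p ∣? m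
  ... | no p∤m = m*n∣⇒n∣ (p ^ suc t) (p ^ e) p^[1+t]*p^e∣n
    where
    p^[1+t]*p^e∣n : p ^ suc t * p ^ e ∣ n
    p^[1+t]*p^e∣n = subst (_∣ n) (^-distribˡ-+-* p (suc t) e)
                      (p∤m∧p^e∣m*n⇒p^e∣n (suc t + e) p∤m p^[1+t+e]∣m*n)
  ... | yes (divides q refl) =
    p^[1+t]∤m∧p^[t+e]∣m*n⇒p^e∣n t e p^[1+t]∤q (*-cancelˡ-∣ p p*p^[t+e]∣p*[q*n])
    where
    x*y*z≡y*[x*z] : ∀ x y z → x * y * z ≡ y * (x * z)
    x*y*z≡y*[x*z] = solve-∀
    p*p^[t+e]∣p*[q*n] : p * p ^ (t + e) ∣ p * (q * n)
    p*p^[t+e]∣p*[q*n] = subst (p ^ suc (t + e) ∣_) (x*y*z≡y*[x*z] q p n) p^[1+t+e]∣m*n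
    p^[1+t]∤q : ¬ p ^ suc t ∣ q
    p^[1+t]∤q p^[1+t]∣q = p^[2+t]∤m (subst (p ^ suc (suc t) ∣_) (*-comm p q) (*-monoʳ-∣ p p^[1+t]∣q))

d∤d*n+r : ∀ {d} n {r} → 0 < r → r < d → ¬ d ∣ d * n + r
d∤d*n+r n 0<r r<d d∣d*n+r = <⇒≱ r<d (∣⇒≤ {{>-nonZero 0<r}} (∣m+n∣m⇒∣n d∣d*n+r (m∣m*n n)))

theorem2p9 : (p m ℓ α s r : ℕ) → Prime p → 1 ≤ m → 1 ≤ ℓ → 1 ≤ α → 1 ≤ s →
    s ≤ α → 1 ≤ r → r < p ^ s →
    (n : ℕ) → p ^ (α ∸ s + 1) ∣ T ℓ (p ^ α * m) (p ^ s * n + r)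
theorem2p9 p m ℓ α (suc t) r p-prime _ _ _ _ s≤α 0<r r<p^s n =
  p^[1+t]∤m∧p^[t+e]∣m*n⇒p^e∣n p-prime t (α ∸ suc t + 1) (d∤d*n+r n 0<r r<p^s) p^[t+e]∣N*T
  where
  N k : ℕ
  N = p ^ suc t * n + r
  k = p ^ α * m
  k∣N*T : k ∣ N * T ℓ k N
  k∣N*T = subst (λ x → k ∣ N * x) (sym (T≡regPart^⋆ ℓ k N)) (k∣θ[f^⋆k] (regPart ℓ) k N)
  x+[y+1]≡1+x+y : ∀ x y → x + (y + 1) ≡ suc x + y
  x+[y+1]≡1+x+y = solve-∀
  t+e≡α : t + (α ∸ suc t + 1) ≡ α
  t+e≡α = trans (x+[y+1]≡1+x+y t (α ∸ suc t)) (m+[n∸m]≡n s≤α)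
  p^[t+e]∣N*T : p ^ (t + (α ∸ suc t + 1)) ∣ N * T ℓ k N
  p^[t+e]∣N*T = subst (λ a → p ^ a ∣ N * T ℓ k N) (sym t+e≡α) (∣-trans (m∣m*n m) k∣N*T)
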